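{- Let $k\ge 1$ and $(s_1,\dots,s_k)\in\mathbb Z_{\ge1}^k$. The following identities hold: (1) $D_i[s_1,\dots,s_k]=s_i[s_1,\dots,s_{i-1},s_i+1,s_{i+1},\dots,s_k]$ for $1\le i\le k$; (2) $D_{k+1}[s_1,\dots,s_k]=-\sum_{j=1}^k s_j[s_1,\dots,s_{j-1},s_j+1,s_{j+1},\dots,s_k]$; (3) $D_i[s_1,\dots,s_k]=0$ for $i\le 0$ or $i\ge k+2$; (4) $D_iD_j=D_jD_i$ for all $i,j\in\mathbb Z$; (5) $\delta_i=\sum_{j=1}^i D_j$ for all $i\in\mathbb Z$ (an empty sum being $0$); (6) $\delta_i\delta_j=\delta_j\delta_i$ for all $i,j\in\mathbb Z$; (7) $[s_1,\dots,s_k]=\dfrac{D_1^{s_1-1}D_2^{s_2-1}\cdots D_k^{s_k-1}}{(s_1-1)!(s_2-1)!\cdots(s_k-1)!}[1,1,\dots,1]$, where $[1,\dots,1]$ has $k$ entries.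
   Context: Let $\mathcal H$ be the $\mathbb Q$-vector space with basis consisting of a symbol $\mathbf 1$ together with symbols $[s_1,\dots,s_k]$ for all $k\ge1$ and $(s_1,\dots,s_k)\in\mathbb Z_{\ge1}^k$. For $i\ge1$ define the linear map $\delta_i:\mathcal H\to\mathcal H$ by $\delta_i(\mathbf 1)=0$ and $\delta_i[s_1,\dots,s_k]=\sum_{j=1}^i s_j[s_1,\dots,s_{j-1},s_j+1,s_{j+1},\dots,s_k]$ if $i\le k$, and $\delta_i[s_1,\dots,s_k]=0$ if $i>k$. Set $\delta_i=0$ for all integers $i\le 0$. For $i\in\mathbb Z$ put $D_i:=\delta_i-\delta_{i-1}$. -}

module Defs where

open import Data.Nat as ℕ using (ℕ; zero; suc; _≤?_; _∸_; _!; NonZero)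
open import Data.Nat.Properties using (_!≢0; m*n≢0)
open import Data.Integer as ℤ using (ℤ; +_; -[1+_])
open import Data.Rational as ℚ using (ℚ; 1ℚ; -_; _+_; _*_)
open import Data.List as List using (List; []; _∷_; _++_; length; concatMap; map; filter)
open import Data.List.Relation.Unary.All as LAll using ()
open import Data.List.Properties using (≡-dec)
open import Data.Vec as Vec using (Vec; lookup; toList; replicate; _[_]%=_)
open import Data.Vec.Relation.Unary.All as VAll using ()
open import Data.Fin as Fin using (Fin; toℕ)
open import Data.Product using (_×_; _,_; proj₁; proj₂)
open import Relation.Nullary using (yes; no)
open import Relation.Binary.PropositionalEquality using (_≡_)
open import Function using (_∘_)

-- The Q-vector space H, modelled as the free Q-vector space on words.
-- A word is a list of naturals; the empty word [] is the symbol 𝟏 and a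
-- nonempty word (s₁,…,s_k) is the symbol [s₁,…,s_k].  The basis of H
-- consists of the words all of whose entries are ≥ 1 (see Positive).
-- An element of H is a formal finite Q-linear combination of words,
-- represented as a list of (coefficient , word) pairs; two such are equal
-- in H (≈) iff they have the same coefficient on every word.

Word : Set
Word = List ℕ

Positive : Word → Set
Positive = LAll.All (λ n → 1 ℕ.≤ n)

InH : List (ℚ × Word) → Set
InH x = LAll.All (Positive ∘ proj₂) x

V : Set
V = List (ℚ × Word)

𝟏 : Word
𝟏 = []

vec : Word → V
vec w = (1ℚ , w) ∷ []

0V : V
0V = []

infixl 6 _⊕_
_⊕_ : V → V → V
x ⊕ y = x ++ y

_·_ : ℚ → V → V
q · x = map (λ p → (q * proj₁ p , proj₂ p)) x

⊖ : V → V
⊖ x = (- 1ℚ) · x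

coeff : V → Word → ℚ
coeff [] w = ℚ.0ℚ
coeff ((q , u) ∷ x) w with ≡-dec ℕ._≟_ u w
... | yes _ = q + coeff x w
... | no  _ = coeff x w

infix 4 _≈_
_≈_ : V → V → Set
x ≈ y = ∀ w → coeff x w ≡ coeff y w

Σᶠ : (k : ℕ) → (Fin k → V) → V
Σᶠ k f = concatMap f (List.allFin k)

-- Σ_{j=1}^{n} s_j [s₁,…,s_j+1,…,s_k]  (terms with j > k absent)
prefixTerms : ℕ → Word → V
prefixTerms zero    _        = []
prefixTerms (suc n) []       = []
prefixTerms (suc n) (x ∷ xs) =
  (+ x ℚ./ 1 , suc x ∷ xs) ∷ map (λ p → (proj₁ p , x ∷ proj₂ p)) (prefixTerms n xs)

δℕw : ℕ → Word → V
δℕw i s with i ≤? length s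
... | yes _ = prefixTerms i s
... | no  _ = []

δw : ℤ → Word → V
δw (+ n)    s = δℕw n s
δw -[1+ n ] s = []

δ : ℤ → V → V
δ i x = concatMap (λ p → proj₁ p · δw i (proj₂ p)) x

D : ℤ → V → V
D i x = δ i x ⊕ ⊖ (δ (i ℤ.- ℤ.+ 1) x)

ΣD : ℤ → V → V
ΣD (+ n)    x = concatMap (λ j → D (+ suc j) x) (List.upTo n)
ΣD -[1+ n ] x = []

iter : ℕ → (V → V) → V → V
iter zero    f x = x
iter (suc n) f x = f (iter n f x)

Dmonomial : {k : ℕ} → Vec ℕ k → V → V
Dmonomial {k} s x =
  List.foldr (λ j acc → iter (lookup s j ∸ 1) (D (+ suc (toℕ j))) acc) x (List.allFin k)

factProd : {k : ℕ} → Vec ℕ k → ℕ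
factProd Vec.[]       = 1
factProd (x Vec.∷ xs) = ((x ∸ 1) !) ℕ.* factProd xs

factProd≢0 : {k : ℕ} (s : Vec ℕ k) → NonZero (factProd s)
factProd≢0 Vec.[]       = _
factProd≢0 (x Vec.∷ xs) =
  m*n≢0 ((x ∸ 1) !) (factProd xs) {{(x ∸ 1) !≢0}} {{factProd≢0 xs}}

invFactProd : {k : ℕ} → Vec ℕ k → ℚ
invFactProd s = (+ 1) ℚ./ factProd s
  where instance _ = factProd≢0 s

-- Each operator is the linear extension of its action on words, and a linear extension is
-- well defined on formal sums, so everything reduces to words.  On a word s of length k ≥ i,
-- δ_i [s] = Σ_{a ≤ i} s_a [s + e_a], and applying δ_j gives
-- Σ_{a ≤ i, b ≤ j} s_a (s_b + [a = b]) [s + e_a + e_b], which is symmetric in i and j (when i or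
-- j exceeds k both sides vanish, as δ preserves length).  Hence the δ_i commute, so do their
-- differences D_i, and Σ_{j ≤ i} D_j telescopes to δ_i.  On a word, D_i keeps only the summand
-- s_i [s + e_i], so D_i^m multiplies by the rising factorial s_i (s_i + 1) ⋯ (s_i + m - 1) while
-- raising s_i by m; starting from [1, …, 1], D_1^{s_1 - 1} ⋯ D_k^{s_k - 1} therefore produces
-- (s_1 - 1)! ⋯ (s_k - 1)! [s].
module Submission where

open import Defs
open import Data.Nat using (ℕ; suc; _≤_)
open import Data.Integer as ℤ using (ℤ; +_)
open import Data.Rational using (_/_)
open import Data.Fin using (Fin; toℕ)
open import Data.Vec using (Vec; lookup; toList; replicate; _[_]%=_)
open import Data.Vec.Relation.Unary.All as VAll using ()
open import Data.Product using (_×_)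
open import Data.Sum using (_⊎_)

open import Data.Empty using (⊥-elim)
import Data.Fin as Fin
import Data.Fin.Properties as FinP
open import Data.Integer using (-[1+_])
import Data.Integer.Properties as ℤP
open import Data.List as List
  using (List; []; _∷_; [_]; length; map; concatMap; upTo; allFin; _∷ʳ_)
open import Data.List.Properties as ListP using (≡-dec)
open import Data.List.Relation.Unary.All as All using (All; []; _∷_)
open import Data.List.Relation.Unary.All.Properties using (map⁺)
open import Data.Nat as ℕ using (zero; _<_; _∸_; _!; _≤?_; s≤s; NonZero)
open import Data.Nat.Coprimality as Coprime using (1-coprimeTo)
open import Data.Nat.Induction using (<-wellFounded)
import Data.Nat.Properties as ℕP
open import Data.Product using (_,_; proj₁; proj₂)
open import Data.Rational as ℚ using (ℚ; mkℚ; 0ℚ; 1ℚ; _+_; _*_; -_; _-_)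
import Data.Rational.Properties as ℚP
open import Algebra.Properties.Group ℚP.+-0-group using (x∙y⁻¹≈ε⇒x≈y; x≈y⇒x∙y⁻¹≈ε)
open import Data.Sum using (inj₁; inj₂)
open import Data.Vec using ([]; _∷_)
import Data.Vec.Properties as VecP
open import Function using (_∘_; id)
open import Induction.WellFounded using (Acc; acc)
open import Level using (0ℓ)
open import Relation.Binary.Bundles using (Setoid)
import Relation.Binary.Reasoning.Setoid as SetoidReasoning
open import Relation.Binary.PropositionalEquality
  using (_≡_; _≢_; refl; sym; trans; cong; cong₂; subst; module ≡-Reasoning)
open import Relation.Nullary using (Dec; yes; no; ¬_)
open import Relation.Nullary.Decidable using (dec-yes; dec-no; dec⇒maybe)
open import Tactic.RingSolver using (solve-∀)
open import Tactic.RingSolver.Core.AlmostCommutativeRing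
  using (AlmostCommutativeRing; fromCommutativeRing)

ℚ-ring : AlmostCommutativeRing 0ℓ 0ℓ
ℚ-ring = fromCommutativeRing ℚP.+-*-commutativeRing (λ p → dec⇒maybe (0ℚ ℚP.≟ p))

fromℕ : ℕ → ℚ
fromℕ n = + n / 1

-- _≈_ wrapped in a record, so that both sides can be inferred from a proof.
infix 4 _≋_
record _≋_ (x y : V) : Set where
  constructor coeffwise
  field coeff-≡ : x ≈ y
open _≋_

≋-setoid : Setoid 0ℓ 0ℓ
≋-setoid = record
  { Carrier       = V
  ; _≈_           = _≋_
  ; isEquivalence = record
    { refl  = coeffwise λ _ → refl
    ; sym   = λ x≋y → coeffwise λ w → sym (coeff-≡ x≋y w)
    ; trans = λ x≋y y≋z → coeffwise λ w → trans (coeff-≡ x≋y w) (coeff-≡ y≋z w)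
    }
  }

open Setoid ≋-setoid public
  using () renaming (refl to ≋-refl; sym to ≋-sym; trans to ≋-trans; reflexive to ≡⇒≋)
module ≋-Reasoning = SetoidReasoning ≋-setoid

infixl 6 _⊟_
_⊟_ : V → V → V
x ⊟ y = x ⊕ ⊖ y

coeff-⊕ : ∀ x y w → coeff (x ⊕ y) w ≡ coeff x w + coeff y w
coeff-⊕ []            y w = sym (ℚP.+-identityˡ _)
coeff-⊕ ((q , u) ∷ x) y w with ≡-dec ℕ._≟_ u w
... | yes _ = trans (cong (_+_ q) (coeff-⊕ x y w)) (sym (ℚP.+-assoc q _ _))
... | no  _ = coeff-⊕ x y w

coeff-· : ∀ q x w → coeff (q · x) w ≡ q * coeff x w
coeff-· q []            w = sym (ℚP.*-zeroʳ q)
coeff-· q ((p , u) ∷ x) w with ≡-dec ℕ._≟_ u w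
... | yes _ = trans (cong (_+_ (q * p)) (coeff-· q x w)) (sym (ℚP.*-distribˡ-+ q p _))
... | no  _ = coeff-· q x w

coeff-⊟ : ∀ x y w → coeff (x ⊟ y) w ≡ coeff x w - coeff y w
coeff-⊟ x y w = begin
    coeff (x ⊕ ⊖ y) w              ≡⟨ coeff-⊕ x (⊖ y) w ⟩
    coeff x w + coeff (⊖ y) w      ≡⟨ cong (_+_ (coeff x w)) (coeff-· (- 1ℚ) y w) ⟩
    coeff x w + - 1ℚ * coeff y w   ≡⟨ cong (_+_ (coeff x w)) (-1*p≡-p (coeff y w)) ⟩
    coeff x w - coeff y w          ∎
  where
  open ≡-Reasoning
  -1*p≡-p : ∀ p → - 1ℚ * p ≡ - p
  -1*p≡-p = solve-∀ ℚ-ring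

coeff-∷-≢ : ∀ {q v w} z → v ≢ w → coeff ((q , v) ∷ z) w ≡ coeff z w
coeff-∷-≢ {v = v} {w} z v≢w rewrite dec-no (≡-dec ℕ._≟_ v w) v≢w = refl

⊕-cong : ∀ {x x′ y y′} → x ≋ x′ → y ≋ y′ → x ⊕ y ≋ x′ ⊕ y′
⊕-cong {x} {x′} {y} {y′} x≋x′ y≋y′ = coeffwise λ w → begin
    coeff (x ⊕ y) w         ≡⟨ coeff-⊕ x y w ⟩
    coeff x w + coeff y w   ≡⟨ cong₂ _+_ (coeff-≡ x≋x′ w) (coeff-≡ y≋y′ w) ⟩
    coeff x′ w + coeff y′ w ≡⟨ coeff-⊕ x′ y′ w ⟨
    coeff (x′ ⊕ y′) w       ∎
  where open ≡-Reasoning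

·-congˡ : ∀ q {x y} → x ≋ y → q · x ≋ q · y
·-congˡ q {x} {y} x≋y = coeffwise λ w →
  trans (coeff-· q x w) (trans (cong (q *_) (coeff-≡ x≋y w)) (sym (coeff-· q y w)))

⊟-cong : ∀ {x x′ y y′} → x ≋ x′ → y ≋ y′ → x ⊟ y ≋ x′ ⊟ y′
⊟-cong x≋x′ y≋y′ = ⊕-cong x≋x′ (·-congˡ (- 1ℚ) y≋y′)

⊕-congˡ : ∀ x {y y′} → y ≋ y′ → x ⊕ y ≋ x ⊕ y′
⊕-congˡ x = ⊕-cong {x} ≋-refl

∷-congˡ : ∀ p {x y} → x ≋ y → p ∷ x ≋ p ∷ y
∷-congˡ p = ⊕-congˡ [ p ]

·-distrib-⊕ : ∀ q x y → q · (x ⊕ y) ≡ q · x ⊕ q · y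
·-distrib-⊕ q = ListP.map-++ _

⊕-lcomm : ∀ x y z → x ⊕ (y ⊕ z) ≋ y ⊕ (x ⊕ z)
⊕-lcomm x y z = coeffwise λ w → begin
    coeff (x ⊕ (y ⊕ z)) w                ≡⟨ expand x y z w ⟩
    coeff x w + (coeff y w + coeff z w)  ≡⟨ lcomm (coeff x w) (coeff y w) (coeff z w) ⟩
    coeff y w + (coeff x w + coeff z w)  ≡⟨ expand y x z w ⟨
    coeff (y ⊕ (x ⊕ z)) w                ∎
  where
  open ≡-Reasoning
  expand : ∀ x y z w → coeff (x ⊕ (y ⊕ z)) w ≡ coeff x w + (coeff y w + coeff z w)
  expand x y z w = trans (coeff-⊕ x (y ⊕ z) w) (cong (_+_ (coeff x w)) (coeff-⊕ y z w))
  lcomm : ∀ a b c → a + (b + c) ≡ b + (a + c)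
  lcomm = solve-∀ ℚ-ring

·-assoc : ∀ p q x → (p * q) · x ≋ p · (q · x)
·-assoc p q x = coeffwise λ w → begin
    coeff ((p * q) · x) w  ≡⟨ coeff-· (p * q) x w ⟩
    p * q * coeff x w      ≡⟨ ℚP.*-assoc p q (coeff x w) ⟩
    p * (q * coeff x w)    ≡⟨ cong (p *_) (coeff-· q x w) ⟨
    p * coeff (q · x) w    ≡⟨ coeff-· p (q · x) w ⟨
    coeff (p · (q · x)) w  ∎
  where open ≡-Reasoning

·-distribʳ-+ : ∀ p q x → (p + q) · x ≋ p · x ⊕ q · x
·-distribʳ-+ p q x = coeffwise λ w → begin
    coeff ((p + q) · x) w                  ≡⟨ coeff-· (p + q) x w ⟩
    (p + q) * coeff x w                    ≡⟨ ℚP.*-distribʳ-+ (coeff x w) p q ⟩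
    p * coeff x w + q * coeff x w          ≡⟨ cong₂ _+_ (coeff-· p x w) (coeff-· q x w) ⟨
    coeff (p · x) w + coeff (q · x) w      ≡⟨ coeff-⊕ (p · x) (q · x) w ⟨
    coeff (p · x ⊕ q · x) w                ∎
  where open ≡-Reasoning

·-distrib-⊟ : ∀ q x y → q · (x ⊟ y) ≋ q · x ⊟ q · y
·-distrib-⊟ q x y = coeffwise λ w → begin
    coeff (q · (x ⊟ y)) w               ≡⟨ coeff-· q (x ⊟ y) w ⟩
    q * coeff (x ⊟ y) w                 ≡⟨ cong (q *_) (coeff-⊟ x y w) ⟩
    q * (coeff x w - coeff y w)         ≡⟨ distrib q (coeff x w) (coeff y w) ⟩
    q * coeff x w - q * coeff y w       ≡⟨ cong₂ _-_ (coeff-· q x w) (coeff-· q y w) ⟨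
    coeff (q · x) w - coeff (q · y) w   ≡⟨ coeff-⊟ (q · x) (q · y) w ⟨
    coeff (q · x ⊟ q · y) w             ∎
  where
  open ≡-Reasoning
  distrib : ∀ q a b → q * (a - b) ≡ q * a - q * b
  distrib = solve-∀ ℚ-ring

·-identityˡ : ∀ x → 1ℚ · x ≋ x
·-identityˡ x = coeffwise λ w → trans (coeff-· 1ℚ x w) (ℚP.*-identityˡ (coeff x w))

·-zeroˡ : ∀ x → 0ℚ · x ≋ 0V
·-zeroˡ x = coeffwise λ w → trans (coeff-· 0ℚ x w) (ℚP.*-zeroˡ (coeff x w))

⊟-interchange : ∀ x y z t → (x ⊟ y) ⊟ (z ⊟ t) ≋ (x ⊟ z) ⊟ (y ⊟ t)
⊟-interchange x y z t = coeffwise λ w → begin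
    coeff ((x ⊟ y) ⊟ (z ⊟ t)) w                      ≡⟨ expand x y z t w ⟩
    (coeff x w - coeff y w) - (coeff z w - coeff t w)  ≡⟨ interchange (coeff x w) _ _ _ ⟩
    (coeff x w - coeff z w) - (coeff y w - coeff t w)  ≡⟨ expand x z y t w ⟨
    coeff ((x ⊟ z) ⊟ (y ⊟ t)) w                      ∎
  where
  open ≡-Reasoning
  expand : ∀ x y z t w →
           coeff ((x ⊟ y) ⊟ (z ⊟ t)) w ≡ (coeff x w - coeff y w) - (coeff z w - coeff t w)
  expand x y z t w = trans (coeff-⊟ (x ⊟ y) (z ⊟ t) w) (cong₂ _-_ (coeff-⊟ x y w) (coeff-⊟ z t w))
  interchange : ∀ a b c d → (a - b) - (c - d) ≡ (a - c) - (b - d)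
  interchange = solve-∀ ℚ-ring

⊕-⊟-cancelʳ : ∀ x y → x ⊕ (y ⊟ x) ≋ y
⊕-⊟-cancelʳ x y = coeffwise λ w → begin
    coeff (x ⊕ (y ⊟ x)) w            ≡⟨ coeff-⊕ x (y ⊟ x) w ⟩
    coeff x w + coeff (y ⊟ x) w      ≡⟨ cong (_+_ (coeff x w)) (coeff-⊟ y x w) ⟩
    coeff x w + (coeff y w - coeff x w) ≡⟨ cancel (coeff x w) (coeff y w) ⟩
    coeff y w                        ∎
  where
  open ≡-Reasoning
  cancel : ∀ a b → a + (b - a) ≡ b
  cancel = solve-∀ ℚ-ring

⊕-⊟-cancelˡ : ∀ x y → (x ⊕ y) ⊟ x ≋ y
⊕-⊟-cancelˡ x y = coeffwise λ w → begin
    coeff ((x ⊕ y) ⊟ x) w              ≡⟨ coeff-⊟ (x ⊕ y) x w ⟩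
    coeff (x ⊕ y) w - coeff x w        ≡⟨ cong (_- coeff x w) (coeff-⊕ x y w) ⟩
    (coeff x w + coeff y w) - coeff x w ≡⟨ cancel (coeff x w) (coeff y w) ⟩
    coeff y w                          ∎
  where
  open ≡-Reasoning
  cancel : ∀ a b → (a + b) - a ≡ b
  cancel = solve-∀ ℚ-ring

≋⇒⊟≋0 : ∀ {x y} → x ≋ y → x ⊟ y ≋ 0V
≋⇒⊟≋0 {x} {y} x≋y = coeffwise λ w → trans (coeff-⊟ x y w) (x≈y⇒x∙y⁻¹≈ε (coeff-≡ x≋y w))

⊟≋0⇒≋ : ∀ {x y} → x ⊟ y ≋ 0V → x ≋ y
⊟≋0⇒≋ {x} {y} x-y≋0 = coeffwise λ w →
  x∙y⁻¹≈ε⇒x≈y (coeff x w) (coeff y w) (trans (sym (coeff-⊟ x y w)) (coeff-≡ x-y≋0 w))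

linExt : (Word → V) → V → V
linExt f x = concatMap (λ p → proj₁ p · f (proj₂ p)) x

linExt-⊕ : ∀ f x y → linExt f (x ⊕ y) ≡ linExt f x ⊕ linExt f y
linExt-⊕ f = ListP.concatMap-++ _

linExt-· : ∀ f q x → linExt f (q · x) ≋ q · linExt f x
linExt-· f q []            = ≋-refl
linExt-· f q ((p , u) ∷ x) = begin
    (q * p) · f u ⊕ linExt f (q · x)  ≈⟨ ⊕-cong (·-assoc q p (f u)) (linExt-· f q x) ⟩
    q · (p · f u) ⊕ q · linExt f x    ≡⟨ ·-distrib-⊕ q (p · f u) (linExt f x) ⟨
    q · (p · f u ⊕ linExt f x)        ∎
  where open ≋-Reasoning

linExt-⊟ : ∀ f x y → linExt f (x ⊟ y) ≋ linExt f x ⊟ linExt f y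
linExt-⊟ f x y = ≋-trans (≡⇒≋ (linExt-⊕ f x (⊖ y))) (⊕-congˡ (linExt f x) (linExt-· f (- 1ℚ) y))

linExt-vec : ∀ f u → linExt f (vec u) ≋ f u
linExt-vec f u = ≋-trans (≡⇒≋ (ListP.++-identityʳ (1ℚ · f u))) (·-identityˡ (f u))

linExt-0 : ∀ x → linExt (λ _ → 0V) x ≡ 0V
linExt-0 []      = refl
linExt-0 (_ ∷ x) = linExt-0 x

linExt-cong-local : ∀ {f g} x → All (λ p → f (proj₂ p) ≋ g (proj₂ p)) x → linExt f x ≋ linExt g x
linExt-cong-local []            []             = ≋-refl
linExt-cong-local ((q , u) ∷ x) (fu≋gu ∷ f≋g) = ⊕-cong (·-congˡ q fu≋gu) (linExt-cong-local x f≋g)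

linExt-∘ : ∀ f g x → linExt g (linExt f x) ≋ linExt (linExt g ∘ f) x
linExt-∘ f g []            = ≋-refl
linExt-∘ f g ((q , u) ∷ x) = begin
    linExt g (q · f u ⊕ linExt f x)             ≡⟨ linExt-⊕ g (q · f u) (linExt f x) ⟩
    linExt g (q · f u) ⊕ linExt g (linExt f x)  ≈⟨ ⊕-cong (linExt-· g q (f u)) (linExt-∘ f g x) ⟩
    q · linExt g (f u) ⊕ linExt (linExt g ∘ f) x ∎
  where open ≋-Reasoning

removeWord : Word → V → V
removeWord u []            = []
removeWord u ((q , v) ∷ z) with ≡-dec ℕ._≟_ v u
... | yes _ = removeWord u z
... | no  _ = (q , v) ∷ removeWord u z

coeff-removeWord-self : ∀ u z → coeff (removeWord u z) u ≡ 0ℚ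
coeff-removeWord-self u []            = refl
coeff-removeWord-self u ((q , v) ∷ z) with ≡-dec ℕ._≟_ v u
... | yes _   = coeff-removeWord-self u z
... | no  v≢u = trans (coeff-∷-≢ (removeWord u z) v≢u) (coeff-removeWord-self u z)

coeff-removeWord-≢ : ∀ {u w} z → w ≢ u → coeff (removeWord u z) w ≡ coeff z w
coeff-removeWord-≢         []            w≢u = refl
coeff-removeWord-≢ {u} {w} ((q , v) ∷ z) w≢u with ≡-dec ℕ._≟_ v u
... | yes refl = trans (coeff-removeWord-≢ z w≢u) (sym (coeff-∷-≢ z (w≢u ∘ sym)))
... | no  _    = begin
    coeff ([ q , v ] ⊕ removeWord u z) w          ≡⟨ coeff-⊕ [ q , v ] (removeWord u z) w ⟩
    coeff [ q , v ] w + coeff (removeWord u z) w  ≡⟨ cong (_+_ head) (coeff-removeWord-≢ z w≢u) ⟩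
    coeff [ q , v ] w + coeff z w                 ≡⟨ coeff-⊕ [ q , v ] z w ⟨
    coeff ([ q , v ] ⊕ z) w                       ∎
  where
  open ≡-Reasoning
  head = coeff [ q , v ] w

removeWord-cong : ∀ u {x y} → x ≋ y → removeWord u x ≋ removeWord u y
removeWord-cong u {x} {y} x≋y = coeffwise λ w → by-cases w (≡-dec ℕ._≟_ w u)
  where
  by-cases : ∀ w → Dec (w ≡ u) → coeff (removeWord u x) w ≡ coeff (removeWord u y) w
  by-cases w (yes refl) = trans (coeff-removeWord-self u x) (sym (coeff-removeWord-self u y))
  by-cases w (no w≢u)   =
    trans (coeff-removeWord-≢ x w≢u) (trans (coeff-≡ x≋y w) (sym (coeff-removeWord-≢ y w≢u)))

length-removeWord : ∀ u z → length (removeWord u z) ≤ length z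
length-removeWord u []            = ℕ.z≤n
length-removeWord u ((q , v) ∷ z) with ≡-dec ℕ._≟_ v u
... | yes _ = ℕP.m≤n⇒m≤1+n (length-removeWord u z)
... | no  _ = s≤s (length-removeWord u z)

length-removeWord-head : ∀ q u z → length (removeWord u ((q , u) ∷ z)) < length ((q , u) ∷ z)
length-removeWord-head q u z rewrite proj₂ (dec-yes (≡-dec ℕ._≟_ u u) refl) =
  s≤s (length-removeWord u z)

linExt-removeWord : ∀ f u z → linExt f z ≋ coeff z u · f u ⊕ linExt f (removeWord u z)
linExt-removeWord f u []            = ≋-sym (≋-trans (≡⇒≋ (ListP.++-identityʳ _)) (·-zeroˡ (f u)))
linExt-removeWord f u ((q , v) ∷ z) with ≡-dec ℕ._≟_ v u | linExt-removeWord f u z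
... | yes refl | ih = begin
    q · f v ⊕ linExt f z                    ≈⟨ ⊕-congˡ (q · f v) ih ⟩
    q · f v ⊕ (coeff z v · f v ⊕ rest)      ≡⟨ ListP.++-assoc (q · f v) (coeff z v · f v) rest ⟨
    (q · f v ⊕ coeff z v · f v) ⊕ rest      ≈⟨ ⊕-cong (·-distribʳ-+ q (coeff z v) (f v)) ≋-refl ⟨
    (q + coeff z v) · f v ⊕ rest            ∎
  where
  open ≋-Reasoning
  rest = linExt f (removeWord v z)
... | no _ | ih =
  ≋-trans (⊕-congˡ (q · f v) ih) (⊕-lcomm (q · f v) (coeff z u · f u) (linExt f (removeWord u z)))

-- A vanishing formal sum may cancel only after regrouping: split off all terms on the
-- first word, whose total coefficient is 0, and recurse on the strictly shorter rest.
linExt-≋0 : ∀ f {z} → z ≋ 0V → linExt f z ≋ 0V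
linExt-≋0 f {z} = go z (<-wellFounded (length z))
  where
  open ≋-Reasoning
  go : ∀ z → Acc _<_ (length z) → z ≋ 0V → linExt f z ≋ 0V
  go []                _         _   = ≋-refl
  go z@((q , u) ∷ z′) (acc rec) z≋0 = begin
      linExt f z                                   ≈⟨ linExt-removeWord f u z ⟩
      coeff z u · f u ⊕ linExt f (removeWord u z)  ≈⟨ ⊕-cong coeff≋0 rest≋0 ⟩
      0V                                           ∎
    where
    coeff≋0 : coeff z u · f u ≋ 0V
    coeff≋0 = ≋-trans (≡⇒≋ (cong (_· f u) (coeff-≡ z≋0 u))) (·-zeroˡ (f u))
    rest≋0 : linExt f (removeWord u z) ≋ 0V
    rest≋0 = go (removeWord u z) (rec (length-removeWord-head q u z′)) (removeWord-cong u z≋0)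

linExt-cong : ∀ f {x y} → x ≋ y → linExt f x ≋ linExt f y
linExt-cong f {x} {y} x≋y = ⊟≋0⇒≋ (begin
    linExt f x ⊟ linExt f y  ≈⟨ linExt-⊟ f x y ⟨
    linExt f (x ⊟ y)         ≈⟨ linExt-≋0 f (≋⇒⊟≋0 x≋y) ⟩
    0V                       ∎)
  where open ≋-Reasoning

prepend : ℕ → V → V
prepend x = map (λ p → (proj₁ p , x ∷ proj₂ p))

prepend-⊕ : ∀ x y z → prepend x (y ⊕ z) ≡ prepend x y ⊕ prepend x z
prepend-⊕ x = ListP.map-++ _

prepend-· : ∀ x q z → prepend x (q · z) ≡ q · prepend x z
prepend-· x q []      = refl
prepend-· x q (p ∷ z) = cong (_ ∷_) (prepend-· x q z)

prepend-≋-linExt : ∀ x z → prepend x z ≋ linExt (λ v → vec (x ∷ v)) z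
prepend-≋-linExt x []            = ≋-refl
prepend-≋-linExt x ((q , v) ∷ z) =
  ≋-trans (∷-congˡ (q , x ∷ v) (prepend-≋-linExt x z))
          (≡⇒≋ (cong (λ r → (r , x ∷ v) ∷ linExt (λ v → vec (x ∷ v)) z) (sym (ℚP.*-identityʳ q))))

prepend-cong : ∀ x {y z} → y ≋ z → prepend x y ≋ prepend x z
prepend-cong x {y} {z} y≋z =
  ≋-trans (prepend-≋-linExt x y)
          (≋-trans (linExt-cong (λ v → vec (x ∷ v)) y≋z) (≋-sym (prepend-≋-linExt x z)))

linExt-prefixTerms-prepend : ∀ j x z →
  linExt (prefixTerms (suc j)) (prepend x z)
    ≋ fromℕ x · prepend (suc x) z ⊕ prepend x (linExt (prefixTerms j) z)
linExt-prefixTerms-prepend j x []            = ≋-refl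
linExt-prefixTerms-prepend j x ((q , v) ∷ z) = begin
    (q * fromℕ x , suc x ∷ v) ∷ (A ⊕ linExt (prefixTerms (suc j)) (prepend x z))
  ≈⟨ ∷-congˡ _ (⊕-congˡ A (linExt-prefixTerms-prepend j x z)) ⟩
    (q * fromℕ x , suc x ∷ v) ∷ (A ⊕ (B ⊕ C))
  ≈⟨ ∷-congˡ _ (⊕-lcomm A B C) ⟩
    (q * fromℕ x , suc x ∷ v) ∷ (B ⊕ (A ⊕ C))
  ≡⟨ cong₂ (λ r t → (r , suc x ∷ v) ∷ (B ⊕ t)) (ℚP.*-comm q (fromℕ x)) prepend-tail ⟩
    (fromℕ x * q , suc x ∷ v) ∷ (B ⊕ prepend x (q · prefixTerms j v ⊕ linExt (prefixTerms j) z))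
  ∎
  where
  open ≋-Reasoning
  A = q · prepend x (prefixTerms j v)
  B = fromℕ x · prepend (suc x) z
  C = prepend x (linExt (prefixTerms j) z)
  prepend-tail : A ⊕ C ≡ prepend x (q · prefixTerms j v ⊕ linExt (prefixTerms j) z)
  prepend-tail = sym (trans (prepend-⊕ x (q · prefixTerms j v) (linExt (prefixTerms j) z))
                            (cong (_⊕ C) (prepend-· x q (prefixTerms j v))))

-- The diagonal term x (x + 1) [x + 2, …] is symmetric in i and j; the two cross terms swap.
prefixTerms-comm : ∀ i j u →
  linExt (prefixTerms j) (prefixTerms i u) ≋ linExt (prefixTerms i) (prefixTerms j u)
prefixTerms-comm zero    j       u        = ≋-sym (≡⇒≋ (linExt-0 (prefixTerms j u)))
prefixTerms-comm (suc i) zero    u        = ≡⇒≋ (linExt-0 (prefixTerms (suc i) u))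
prefixTerms-comm (suc i) (suc j) []       = ≋-refl
prefixTerms-comm (suc i) (suc j) (x ∷ xs) = begin
    Aj ⊕ linExt (prefixTerms (suc j)) (prepend x (prefixTerms i xs))
  ≈⟨ ⊕-congˡ Aj (linExt-prefixTerms-prepend j x (prefixTerms i xs)) ⟩
    diagonal ∷ (Bj ⊕ (Bi ⊕ prepend x (linExt (prefixTerms j) (prefixTerms i xs))))
  ≈⟨ ∷-congˡ diagonal (⊕-congˡ Bj (⊕-congˡ Bi (prepend-cong x (prefixTerms-comm i j xs)))) ⟩
    diagonal ∷ (Bj ⊕ (Bi ⊕ prepend x (linExt (prefixTerms i) (prefixTerms j xs))))
  ≈⟨ ∷-congˡ diagonal (⊕-lcomm Bj Bi _) ⟩
    diagonal ∷ (Bi ⊕ (Bj ⊕ prepend x (linExt (prefixTerms i) (prefixTerms j xs))))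
  ≈⟨ ⊕-congˡ Ai (linExt-prefixTerms-prepend i x (prefixTerms j xs)) ⟨
    Ai ⊕ linExt (prefixTerms (suc i)) (prepend x (prefixTerms j xs))
  ∎
  where
  open ≋-Reasoning
  diagonal = (fromℕ x * fromℕ (suc x) , suc (suc x) ∷ xs)
  Ai = fromℕ x · prefixTerms (suc i) (suc x ∷ xs)
  Aj = fromℕ x · prefixTerms (suc j) (suc x ∷ xs)
  Bi = fromℕ x · prepend (suc x) (prefixTerms i xs)
  Bj = fromℕ x · prepend (suc x) (prefixTerms j xs)

δℕw-≤ : ∀ {n u} → n ≤ length u → δℕw n u ≡ prefixTerms n u
δℕw-≤ {n} {u} n≤ with n ≤? length u
... | yes _  = refl
... | no  n≰ = ⊥-elim (n≰ n≤)

δℕw-≰ : ∀ {n u} → ¬ n ≤ length u → δℕw n u ≡ 0V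
δℕw-≰ {n} {u} n≰ with n ≤? length u
... | yes n≤ = ⊥-elim (n≰ n≤)
... | no  _  = refl

OfLength : ℕ → V → Set
OfLength m = All (λ p → length (proj₂ p) ≡ m)

prefixTerms-length : ∀ n u → OfLength (length u) (prefixTerms n u)
prefixTerms-length zero    u        = []
prefixTerms-length (suc n) []       = []
prefixTerms-length (suc n) (x ∷ xs) = refl ∷ map⁺ (All.map (cong suc) (prefixTerms-length n xs))

δℕw-length : ∀ n u → OfLength (length u) (δℕw n u)
δℕw-length n u with n ≤? length u
... | yes _ = prefixTerms-length n u
... | no  _ = []

linExt-δℕw-≤ : ∀ {n m} z → OfLength m z → n ≤ m → linExt (δℕw n) z ≋ linExt (prefixTerms n) z
linExt-δℕw-≤ z ofLength n≤m =
  linExt-cong-local z (All.map (λ { refl → ≡⇒≋ (δℕw-≤ n≤m) }) ofLength)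

linExt-δℕw-≰ : ∀ {n m} z → OfLength m z → ¬ n ≤ m → linExt (δℕw n) z ≋ 0V
linExt-δℕw-≰ z ofLength n≰m =
  ≋-trans (linExt-cong-local z (All.map (λ { refl → ≡⇒≋ (δℕw-≰ n≰m) }) ofLength)) (≡⇒≋ (linExt-0 z))

δℕw-comm : ∀ a b u → linExt (δℕw a) (δℕw b u) ≋ linExt (δℕw b) (δℕw a u)
δℕw-comm a b u = by-cases (a ≤? length u) (b ≤? length u)
  where
  open ≋-Reasoning
  by-cases : Dec (a ≤ length u) → Dec (b ≤ length u) →
             linExt (δℕw a) (δℕw b u) ≋ linExt (δℕw b) (δℕw a u)
  by-cases (yes a≤) (yes b≤) = begin
    linExt (δℕw a) (δℕw b u)                  ≈⟨ linExt-δℕw-≤ (δℕw b u) (δℕw-length b u) a≤ ⟩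
    linExt (prefixTerms a) (δℕw b u)          ≡⟨ cong (linExt (prefixTerms a)) (δℕw-≤ b≤) ⟩
    linExt (prefixTerms a) (prefixTerms b u)  ≈⟨ prefixTerms-comm b a u ⟩
    linExt (prefixTerms b) (prefixTerms a u)  ≡⟨ cong (linExt (prefixTerms b)) (δℕw-≤ a≤) ⟨
    linExt (prefixTerms b) (δℕw a u)          ≈⟨ linExt-δℕw-≤ (δℕw a u) (δℕw-length a u) b≤ ⟨
    linExt (δℕw b) (δℕw a u)                  ∎
  by-cases (no a≰) _ = begin
    linExt (δℕw a) (δℕw b u)  ≈⟨ linExt-δℕw-≰ (δℕw b u) (δℕw-length b u) a≰ ⟩
    0V                        ≡⟨ cong (linExt (δℕw b)) (δℕw-≰ a≰) ⟨
    linExt (δℕw b) (δℕw a u)  ∎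
  by-cases (yes _) (no b≰) = begin
    linExt (δℕw a) (δℕw b u)  ≡⟨ cong (linExt (δℕw a)) (δℕw-≰ b≰) ⟩
    0V                        ≈⟨ linExt-δℕw-≰ (δℕw a u) (δℕw-length a u) b≰ ⟨
    linExt (δℕw b) (δℕw a u)  ∎

δw-comm : ∀ i j u → linExt (δw i) (δw j u) ≋ linExt (δw j) (δw i u)
δw-comm -[1+ _ ] j        u = ≡⇒≋ (linExt-0 (δw j u))
δw-comm (+ a)    -[1+ _ ] u = ≋-sym (≡⇒≋ (linExt-0 (δw (+ a) u)))
δw-comm (+ a)    (+ b)    u = δℕw-comm a b u

δ-comm : ∀ i j x → δ i (δ j x) ≋ δ j (δ i x)
δ-comm i j x = begin
    δ i (δ j x)            ≈⟨ linExt-∘ (δw j) (δw i) x ⟩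
    linExt (δ i ∘ δw j) x  ≈⟨ linExt-cong-local x (All.universal (δw-comm i j ∘ proj₂) x) ⟩
    linExt (δ j ∘ δw i) x  ≈⟨ linExt-∘ (δw i) (δw j) x ⟨
    δ j (δ i x)            ∎
  where open ≋-Reasoning

D-comm : ∀ i j x → D i (D j x) ≋ D j (D i x)
D-comm i j x = begin
    D i (D j x)
  ≈⟨ ⊟-cong (linExt-⊟ (δw i) (δ j x) (δ j′ x)) (linExt-⊟ (δw i′) (δ j x) (δ j′ x)) ⟩
    (δ i (δ j x) ⊟ δ i (δ j′ x)) ⊟ (δ i′ (δ j x) ⊟ δ i′ (δ j′ x))
  ≈⟨ ⊟-interchange (δ i (δ j x)) (δ i (δ j′ x)) (δ i′ (δ j x)) (δ i′ (δ j′ x)) ⟩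
    (δ i (δ j x) ⊟ δ i′ (δ j x)) ⊟ (δ i (δ j′ x) ⊟ δ i′ (δ j′ x))
  ≈⟨ ⊟-cong (⊟-cong (δ-comm i j x) (δ-comm i′ j x)) (⊟-cong (δ-comm i j′ x) (δ-comm i′ j′ x)) ⟩
    (δ j (δ i x) ⊟ δ j (δ i′ x)) ⊟ (δ j′ (δ i x) ⊟ δ j′ (δ i′ x))
  ≈⟨ ⊟-cong (linExt-⊟ (δw j) (δ i x) (δ i′ x)) (linExt-⊟ (δw j′) (δ i x) (δ i′ x)) ⟨
    D j (D i x)
  ∎
  where
  open ≋-Reasoning
  i′ = i ℤ.- + 1
  j′ = j ℤ.- + 1

ΣD-+ : ∀ n x → ΣD (+ n) x ≋ δ (+ n) x
ΣD-+ zero    x = ≋-sym (≡⇒≋ (linExt-0 x))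
ΣD-+ (suc n) x = begin
    concatMap Dx (upTo (suc n))                 ≡⟨ cong (concatMap Dx) (ListP.upTo-∷ʳ n) ⟨
    concatMap Dx (upTo n ∷ʳ n)                  ≡⟨ ListP.concatMap-++ Dx (upTo n) [ n ] ⟩
    ΣD (+ n) x ⊕ (D (+ suc n) x ⊕ 0V)          ≈⟨ ⊕-cong (ΣD-+ n x) (≡⇒≋ (ListP.++-identityʳ _)) ⟩
    δ (+ n) x ⊕ (δ (+ suc n) x ⊟ δ (+ n) x)     ≈⟨ ⊕-⊟-cancelʳ (δ (+ n) x) (δ (+ suc n) x) ⟩
    δ (+ suc n) x                               ∎
  where
  open ≋-Reasoning
  Dx : ℕ → V
  Dx j = D (+ suc j) x

δ≋ΣD : ∀ i x → δ i x ≋ ΣD i x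
δ≋ΣD (+ n)    x = ≋-sym (ΣD-+ n x)
δ≋ΣD -[1+ _ ] x = ≡⇒≋ (linExt-0 x)

bump : ∀ {k} → Vec ℕ k → Fin k → V
bump s i = fromℕ (lookup s i) · vec (toList (s [ i ]%= suc))

allFin-suc : ∀ k → allFin (suc k) ≡ Fin.zero ∷ map Fin.suc (allFin k)
allFin-suc k = cong (Fin.zero ∷_) (sym (ListP.map-tabulate id Fin.suc))

prefixTerms-suc : ∀ {k} (s : Vec ℕ k) i →
  prefixTerms (suc (toℕ i)) (toList s) ≋ prefixTerms (toℕ i) (toList s) ⊕ bump s i
prefixTerms-suc (x ∷ xs) Fin.zero    =
  ≡⇒≋ (cong (λ r → [ r , suc x ∷ toList xs ]) (sym (ℚP.*-identityʳ (fromℕ x))))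
prefixTerms-suc (x ∷ xs) (Fin.suc i) = begin
    (fromℕ x , suc x ∷ toList xs) ∷ prepend x (prefixTerms (suc (toℕ i)) (toList xs))
  ≈⟨ ∷-congˡ _ (prepend-cong x (prefixTerms-suc xs i)) ⟩
    (fromℕ x , suc x ∷ toList xs) ∷ prepend x (prefixTerms (toℕ i) (toList xs) ⊕ bump xs i)
  ≡⟨ cong (_ ∷_) (prepend-⊕ x (prefixTerms (toℕ i) (toList xs)) (bump xs i)) ⟩
    (fromℕ x , suc x ∷ toList xs)
      ∷ (prepend x (prefixTerms (toℕ i) (toList xs)) ⊕ bump (x ∷ xs) (Fin.suc i))
  ∎
  where open ≋-Reasoning

prefixTerms-Σᶠ : ∀ {k} (s : Vec ℕ k) → prefixTerms k (toList s) ≋ Σᶠ k (bump s)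
prefixTerms-Σᶠ []              = ≋-refl
prefixTerms-Σᶠ {suc k} (x ∷ xs) = begin
    (fromℕ x , suc x ∷ toList xs) ∷ prepend x (prefixTerms k (toList xs))
  ≈⟨ ∷-congˡ _ (prepend-cong x (prefixTerms-Σᶠ xs)) ⟩
    (fromℕ x , suc x ∷ toList xs) ∷ prepend x (concatMap (bump xs) (allFin k))
  ≡⟨ cong₂ (λ r t → (r , suc x ∷ toList xs) ∷ t) (sym (ℚP.*-identityʳ (fromℕ x))) prepend-Σᶠ ⟩
    bump (x ∷ xs) Fin.zero ⊕ concatMap (bump (x ∷ xs)) (map Fin.suc (allFin k))
  ≡⟨ cong (concatMap (bump (x ∷ xs))) (allFin-suc k) ⟨
    Σᶠ (suc k) (bump (x ∷ xs))
  ∎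
  where
  open ≋-Reasoning
  prepend-Σᶠ : prepend x (concatMap (bump xs) (allFin k))
             ≡ concatMap (bump (x ∷ xs)) (map Fin.suc (allFin k))
  prepend-Σᶠ = trans (ListP.map-concatMap _ (bump xs) (allFin k))
                     (sym (ListP.concatMap-map (bump (x ∷ xs)) Fin.suc (allFin k)))

D-vec : ∀ i u → D i (vec u) ≋ δw i u ⊟ δw (i ℤ.- + 1) u
D-vec i u = ⊟-cong (linExt-vec (δw i) u) (linExt-vec (δw (i ℤ.- + 1)) u)

D-basis : ∀ {k} (s : Vec ℕ k) i → D (+ suc (toℕ i)) (vec (toList s)) ≋ bump s i
D-basis s i = begin
    D (+ suc (toℕ i)) (vec u)                ≈⟨ D-vec (+ suc (toℕ i)) u ⟩
    δℕw (suc (toℕ i)) u ⊟ δℕw (toℕ i) u      ≡⟨ cong₂ _⊟_ (δℕw-≤ i<) (δℕw-≤ (ℕP.<⇒≤ i<)) ⟩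
    prefixTerms (suc (toℕ i)) u ⊟ before     ≈⟨ ⊟-cong (prefixTerms-suc s i) ≋-refl ⟩
    (before ⊕ bump s i) ⊟ before             ≈⟨ ⊕-⊟-cancelˡ before (bump s i) ⟩
    bump s i                                 ∎
  where
  open ≋-Reasoning
  u = toList s
  before = prefixTerms (toℕ i) u
  i< : suc (toℕ i) ≤ length u
  i< = subst (suc (toℕ i) ≤_) (sym (VecP.length-toList s)) (FinP.toℕ<n i)

D-basis-suc-length : ∀ {k} (s : Vec ℕ k) → D (+ suc k) (vec (toList s)) ≋ ⊖ (Σᶠ k (bump s))
D-basis-suc-length {k} s = begin
    D (+ suc k) (vec u)              ≈⟨ D-vec (+ suc k) u ⟩
    δℕw (suc k) u ⊟ δℕw k u          ≡⟨ cong₂ _⊟_ (δℕw-≰ {u = u} (ℕP.<⇒≱ (s≤s ≤k))) (δℕw-≤ k≤) ⟩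
    ⊖ (prefixTerms k u)              ≈⟨ ·-congˡ (- 1ℚ) (prefixTerms-Σᶠ s) ⟩
    ⊖ (Σᶠ k (bump s))                ∎
  where
  open ≋-Reasoning
  u = toList s
  ≤k : length u ≤ k
  ≤k = ℕP.≤-reflexive (VecP.length-toList s)
  k≤ : k ≤ length u
  k≤ = ℕP.≤-reflexive (sym (VecP.length-toList s))

D-basis-outside : ∀ {k} (s : Vec ℕ k) i → (i ℤ.≤ + 0 ⊎ + suc (suc k) ℤ.≤ i) →
                  D i (vec (toList s)) ≋ 0V
D-basis-outside s (+ zero)  _                            = ≋-refl
D-basis-outside s -[1+ _ ]  _                            = ≋-refl
D-basis-outside s (+ suc n) (inj₁ (ℤ.+≤+ ()))
D-basis-outside s (+ suc n) (inj₂ (ℤ.+≤+ (s≤s length<n))) = begin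
    D (+ suc n) (vec u)       ≈⟨ D-vec (+ suc n) u ⟩
    δℕw (suc n) u ⊟ δℕw n u   ≡⟨ cong₂ _⊟_ (δℕw-≰ {u = u} 1+n≰) (δℕw-≰ {u = u} n≰) ⟩
    0V                        ∎
  where
  open ≋-Reasoning
  u = toList s
  n≰ : ¬ n ≤ length u
  n≰ = ℕP.<⇒≱ (subst (_< n) (sym (VecP.length-toList s)) length<n)
  1+n≰ : ¬ suc n ≤ length u
  1+n≰ = n≰ ∘ ℕP.≤-trans (ℕP.n≤1+n n)

fromℕ≡mkℚ : ∀ n → fromℕ n ≡ mkℚ (+ n) 0 (Coprime.sym (1-coprimeTo n))
fromℕ≡mkℚ n = ℚP.normalize-coprime (Coprime.sym (1-coprimeTo n))

fromℕ-* : ∀ a b → fromℕ (a ℕ.* b) ≡ fromℕ a * fromℕ b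
fromℕ-* a b =
  trans (cong (_/ 1) (ℤP.pos-* a b)) (sym (cong₂ _*_ (fromℕ≡mkℚ a) (fromℕ≡mkℚ b)))

1/n*n≡1 : ∀ n .{{_ : NonZero n}} → (+ 1 / n) * fromℕ n ≡ 1ℚ
1/n*n≡1 (suc d) =
  trans (cong₂ _*_ (ℚP.normalize-coprime (1-coprimeTo (suc d))) (fromℕ≡mkℚ (suc d)))
        (ℚP.*-inverseˡ (mkℚ (+ suc d) 0 (Coprime.sym (1-coprimeTo (suc d)))))

rising : ℕ → ℕ → ℕ
rising a zero    = 1
rising a (suc m) = rising a m ℕ.* (m ℕ.+ a)

rising-1 : ∀ m → rising 1 m ≡ m !
rising-1 zero    = refl
rising-1 (suc m) = begin
  rising 1 m ℕ.* (m ℕ.+ 1)  ≡⟨ cong₂ ℕ._*_ (rising-1 m) (ℕP.+-comm m 1) ⟩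
  m ! ℕ.* suc m             ≡⟨ ℕP.*-comm (m !) (suc m) ⟩
  suc m !                   ∎
  where open ≡-Reasoning

D-cong : ∀ i {x y} → x ≋ y → D i x ≋ D i y
D-cong i x≋y = ⊟-cong (linExt-cong (δw i) x≋y) (linExt-cong (δw (i ℤ.- + 1)) x≋y)

D-· : ∀ i q x → D i (q · x) ≋ q · D i x
D-· i q x = ≋-trans (⊟-cong (linExt-· (δw i) q x) (linExt-· (δw (i ℤ.- + 1)) q x))
                    (≋-sym (·-distrib-⊟ q (δ i x) (δ (i ℤ.- + 1) x)))

iter-cong : ∀ m {f} → (∀ {x y} → x ≋ y → f x ≋ f y) → ∀ {x y} → x ≋ y → iter m f x ≋ iter m f y
iter-cong zero    f-cong x≋y = x≋y
iter-cong (suc m) f-cong x≋y = f-cong (iter-cong m f-cong x≋y)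

iterate-D-basis : ∀ {k} m (j : Fin k) (w : Vec ℕ k) c →
  iter m (D (+ suc (toℕ j))) (c · vec (toList w))
    ≋ (c * fromℕ (rising (lookup w j) m)) · vec (toList (w [ j ]%= (m ℕ.+_)))
iterate-D-basis zero    j w c =
  ≡⇒≋ (cong₂ (λ r v → r · vec (toList v)) (sym (ℚP.*-identityʳ c)) (sym (VecP.[]%=-id w j)))
iterate-D-basis (suc m) j w c = begin
    Dⱼ (iter m Dⱼ (c · vec (toList w)))  ≈⟨ D-cong jᵢ (iterate-D-basis m j w c) ⟩
    Dⱼ (c′ · vec (toList w′))            ≈⟨ D-· jᵢ c′ (vec (toList w′)) ⟩
    c′ · Dⱼ (vec (toList w′))            ≈⟨ ·-congˡ c′ (D-basis w′ j) ⟩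
    c′ · (fromℕ (lookup w′ j) · vec (toList (w′ [ j ]%= suc)))
  ≈⟨ ·-assoc c′ (fromℕ (lookup w′ j)) (vec (toList (w′ [ j ]%= suc))) ⟨
    (c′ * fromℕ (lookup w′ j)) · vec (toList (w′ [ j ]%= suc))
  ≡⟨ cong₂ (λ r v → r · vec (toList v)) coefficient (VecP.[]%=-∘ w j) ⟩
    (c * fromℕ (rising (lookup w j) (suc m))) · vec (toList (w [ j ]%= (suc m ℕ.+_)))
  ∎
  where
  open ≋-Reasoning
  jᵢ = + suc (toℕ j)
  Dⱼ = D jᵢ
  r = rising (lookup w j) m
  c′ = c * fromℕ r
  w′ = w [ j ]%= (m ℕ.+_)
  coefficient : c′ * fromℕ (lookup w′ j) ≡ c * fromℕ (r ℕ.* (m ℕ.+ lookup w j))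
  coefficient = trans (cong (λ a → c′ * fromℕ a) (VecP.lookup∘updateAt j w))
                      (trans (ℚP.*-assoc c (fromℕ r) (fromℕ (m ℕ.+ lookup w j)))
                             (cong (c *_) (sym (fromℕ-* r (m ℕ.+ lookup w j)))))

Dmonomial-over : ∀ {k} → Vec ℕ k → List (Fin k) → V → V
Dmonomial-over s js x = List.foldr (λ j acc → iter (lookup s j ∸ 1) (D (+ suc (toℕ j))) acc) x js

monomialWord : ∀ {k} → Vec ℕ k → List (Fin k) → Vec ℕ k → Vec ℕ k
monomialWord s js w = List.foldr (λ j v → v [ j ]%= ((lookup s j ∸ 1) ℕ.+_)) w js

monomialCoeff : ∀ {k} → Vec ℕ k → List (Fin k) → Vec ℕ k → ℕ
monomialCoeff s []       w = 1
monomialCoeff s (j ∷ js) w =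
  monomialCoeff s js w ℕ.* rising (lookup (monomialWord s js w) j) (lookup s j ∸ 1)

Dmonomial-over-basis : ∀ {k} (s : Vec ℕ k) js w →
  Dmonomial-over s js (vec (toList w))
    ≋ fromℕ (monomialCoeff s js w) · vec (toList (monomialWord s js w))
Dmonomial-over-basis s []       w = ≋-sym (·-identityˡ (vec (toList w)))
Dmonomial-over-basis s (j ∷ js) w = begin
    iter m Dⱼ (Dmonomial-over s js (vec (toList w)))
  ≈⟨ iter-cong m (D-cong (+ suc (toℕ j))) (Dmonomial-over-basis s js w) ⟩
    iter m Dⱼ (fromℕ c · vec (toList w′))
  ≈⟨ iterate-D-basis m j w′ (fromℕ c) ⟩
    (fromℕ c * fromℕ (rising (lookup w′ j) m)) · vec (toList (w′ [ j ]%= (m ℕ.+_)))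
  ≡⟨ cong (_· vec (toList (w′ [ j ]%= (m ℕ.+_)))) (fromℕ-* c (rising (lookup w′ j) m)) ⟨
    fromℕ (monomialCoeff s (j ∷ js) w) · vec (toList (monomialWord s (j ∷ js) w))
  ∎
  where
  open ≋-Reasoning
  m = lookup s j ∸ 1
  Dⱼ = D (+ suc (toℕ j))
  c = monomialCoeff s js w
  w′ = monomialWord s js w

monomialWord-suc : ∀ {k} y (ys : Vec ℕ k) js x w →
  monomialWord (y ∷ ys) (map Fin.suc js) (x ∷ w) ≡ x ∷ monomialWord ys js w
monomialWord-suc y ys []       x w = refl
monomialWord-suc y ys (j ∷ js) x w =
  cong (_[ Fin.suc j ]%= ((lookup ys j ∸ 1) ℕ.+_)) (monomialWord-suc y ys js x w)

monomialCoeff-suc : ∀ {k} y (ys : Vec ℕ k) js x w →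
  monomialCoeff (y ∷ ys) (map Fin.suc js) (x ∷ w) ≡ monomialCoeff ys js w
monomialCoeff-suc y ys []       x w = refl
monomialCoeff-suc y ys (j ∷ js) x w =
  cong₂ (λ c v → c ℕ.* rising (lookup v (Fin.suc j)) (lookup ys j ∸ 1))
        (monomialCoeff-suc y ys js x w) (monomialWord-suc y ys js x w)

monomialWord-ones : ∀ {k} (s : Vec ℕ k) → VAll.All (λ n → 1 ≤ n) s →
  monomialWord s (allFin k) (replicate k 1) ≡ s
monomialWord-ones []       VAll.[]           = refl
monomialWord-ones {suc k} (y ∷ ys) (1≤y VAll.∷ 1≤ys) = begin
    monomialWord (y ∷ ys) (allFin (suc k)) (1 ∷ replicate k 1)
  ≡⟨ cong (λ js → monomialWord (y ∷ ys) js (1 ∷ replicate k 1)) (allFin-suc k) ⟩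
    monomialWord (y ∷ ys) (map Fin.suc (allFin k)) (1 ∷ replicate k 1) [ Fin.zero ]%= ((y ∸ 1) ℕ.+_)
  ≡⟨ cong (_[ Fin.zero ]%= ((y ∸ 1) ℕ.+_)) (monomialWord-suc y ys (allFin k) 1 (replicate k 1)) ⟩
    (y ∸ 1) ℕ.+ 1 ∷ monomialWord ys (allFin k) (replicate k 1)
  ≡⟨ cong₂ _∷_ (ℕP.m∸n+n≡m 1≤y) (monomialWord-ones ys 1≤ys) ⟩
    y ∷ ys
  ∎
  where open ≡-Reasoning

monomialCoeff-ones : ∀ {k} (s : Vec ℕ k) → monomialCoeff s (allFin k) (replicate k 1) ≡ factProd s
monomialCoeff-ones []                = refl
monomialCoeff-ones {suc k} (y ∷ ys) = begin
    monomialCoeff (y ∷ ys) (allFin (suc k)) (1 ∷ ones)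
  ≡⟨ cong (λ js → monomialCoeff (y ∷ ys) js (1 ∷ ones)) (allFin-suc k) ⟩
    monomialCoeff (y ∷ ys) shifted (1 ∷ ones)
      ℕ.* rising (lookup (monomialWord (y ∷ ys) shifted (1 ∷ ones)) Fin.zero) (y ∸ 1)
  ≡⟨ cong₂ (λ c v → c ℕ.* rising (lookup v Fin.zero) (y ∸ 1))
           (monomialCoeff-suc y ys (allFin k) 1 ones) (monomialWord-suc y ys (allFin k) 1 ones) ⟩
    monomialCoeff ys (allFin k) ones ℕ.* rising 1 (y ∸ 1)
  ≡⟨ cong₂ ℕ._*_ (monomialCoeff-ones ys) (rising-1 (y ∸ 1)) ⟩
    factProd ys ℕ.* (y ∸ 1) !
  ≡⟨ ℕP.*-comm (factProd ys) ((y ∸ 1) !) ⟩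
    factProd (y ∷ ys)
  ∎
  where
  open ≡-Reasoning
  ones = replicate k 1
  shifted = map Fin.suc (allFin k)

basis≋Dmonomial : ∀ {k} (s : Vec ℕ k) → VAll.All (λ n → 1 ≤ n) s →
  vec (toList s) ≋ invFactProd s · Dmonomial s (vec (toList (replicate k 1)))
basis≋Dmonomial {k} s 1≤s = ≋-sym (begin
    invFactProd s · Dmonomial-over s (allFin k) (vec (toList ones))
  ≈⟨ ·-congˡ (invFactProd s) (Dmonomial-over-basis s (allFin k) ones) ⟩
    invFactProd s · (fromℕ (monomialCoeff s (allFin k) ones)
                      · vec (toList (monomialWord s (allFin k) ones)))
  ≡⟨ cong₂ (λ c w → invFactProd s · (fromℕ c · vec (toList w)))
           (monomialCoeff-ones s) (monomialWord-ones s 1≤s) ⟩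
    invFactProd s · (fromℕ (factProd s) · vec (toList s))
  ≈⟨ ·-assoc (invFactProd s) (fromℕ (factProd s)) (vec (toList s)) ⟨
    (invFactProd s * fromℕ (factProd s)) · vec (toList s)
  ≡⟨ cong (_· vec (toList s)) (1/n*n≡1 (factProd s) {{factProd≢0 s}}) ⟩
    1ℚ · vec (toList s)
  ≈⟨ ·-identityˡ (vec (toList s)) ⟩
    vec (toList s)
  ∎)
  where
  open ≋-Reasoning
  ones = replicate k 1

lemma2p2 :
    (∀ (k : ℕ) → 1 ≤ k → (s : Vec ℕ k) → VAll.All (λ n → 1 ≤ n) s →
       (∀ (i : Fin k) → D (+ suc (toℕ i)) (vec (toList s))
                          ≈ (+ lookup s i / 1) · vec (toList (s [ i ]%= suc)))
     × (D (+ suc k) (vec (toList s))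
          ≈ ⊖ (Σᶠ k (λ j → (+ lookup s j / 1) · vec (toList (s [ j ]%= suc)))))
     × (∀ (i : ℤ) → (i ℤ.≤ + 0 ⊎ + suc (suc k) ℤ.≤ i) → D i (vec (toList s)) ≈ 0V)
     × (vec (toList s) ≈ invFactProd s · Dmonomial s (vec (toList (replicate k 1)))))
    × (∀ (i j : ℤ) (x : V) → InH x → D i (D j x) ≈ D j (D i x))
    × (∀ (i : ℤ) (x : V) → InH x → δ i x ≈ ΣD i x)
    × (∀ (i j : ℤ) (x : V) → InH x → δ i (δ j x) ≈ δ j (δ i x))
-- The identities hold for every formal sum and every k.
lemma2p2 =
    (λ k _ s 1≤s →
         (λ i → coeff-≡ (D-basis s i))
       , coeff-≡ (D-basis-suc-length s)
       , (λ i outside → coeff-≡ (D-basis-outside s i outside))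
       , coeff-≡ (basis≋Dmonomial s 1≤s))
  , (λ i j x _ → coeff-≡ (D-comm i j x))
  , (λ i x _ → coeff-≡ (δ≋ΣD i x))
  , (λ i j x _ → coeff-≡ (δ-comm i j x))
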